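{- In the Cantor domain, an element is strongly maximal if and only if it is both sharp and maximal. In the Baire domain, the strongly maximal elements are exactly the elements that are both sharp and maximal if and only if Markov's Principle holds.
   Context: We work constructively: informal set theory without excluded middle or choice. For a set $A$, let $A^*$ be the set of finite sequences on $A$ ordered by the prefix order $\preceq$, and let $\mathcal A$ be its ideal completion: the set of subsets of $A^*$ that are lower sets and directed (inhabited, any two elements have a common extension in the subset), ordered by inclusion, with directed suprema given by unions. The Cantor domain is this construction for $A=\{0,1\}$, and the Baire domain for $A=\mathbb N$. In a dcpo, $x\ll y$ if for every directed $S$ with $y\sqsubseteq\bigsqcup S$ some $s\in S$ has $x\sqsubseteq s$. Scott open sets are upper sets $U$ such that $\bigsqcup S\in U$ for directed $S$ implies some $s\in S$ lies in $U$. An element $x$ is maximal if $x\sqsubseteq y$ implies $y\sqsubseteq x$; sharp if for all $u\ll v$, $u\ll x$ or $\neg(v\sqsubseteq x)$; strongly maximal if for all $u\ll v$, $u\ll x$ or there are disjoint Scott opens containing $v$ and $x$ respectively. Markov's Principle: for every $\phi:\mathbb N\to\{0,1\}$, if $\neg(\forall n\,\phi(n)=0)$ then there exists $k$ with $\phi(k)=1$. -}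

module Defs where

open import Data.List using (List; _++_)
open import Data.Product using (Σ; ∃; ∃-syntax; _×_; _,_; proj₁; proj₂)
open import Data.Sum using (_⊎_)
open import Data.Empty using (⊥)
open import Data.Bool using (Bool; true; false)
open import Data.Nat using (ℕ)
open import Relation.Nullary using (¬_)
open import Relation.Binary.PropositionalEquality using (_≡_)

_≼_ : {A : Set} → List A → List A → Set
xs ≼ ys = ∃[ zs ] (xs ++ zs ≡ ys)

-- The ideal completion 𝒜 of (A*, ≼): subsets of A* that are lower sets
-- and directed (inhabited, any two elements have a common extension in
-- the subset), ordered by inclusion.

record Ideal (A : Set) : Set₁ where
  field
    elem      : List A → Set
    lower     : ∀ {s t} → s ≼ t → elem t → elem s
    inhabited : ∃[ s ] elem s
    directed  : ∀ {s t} → elem s → elem t → ∃[ u ] (elem u × s ≼ u × t ≼ u)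
open Ideal public

module _ {A : Set} where

  _⊑_ : Ideal A → Ideal A → Set
  x ⊑ y = ∀ s → elem x s → elem y s

  Directed : {I : Set} → (I → Ideal A) → Set
  Directed {I} S = I × (∀ i j → ∃[ k ] (S i ⊑ S k × S j ⊑ S k))

  ⨆ : {I : Set} (S : I → Ideal A) → Directed S → Ideal A
  ⨆ {I} S (i₀ , dir) = record
    { elem      = λ s → ∃[ i ] elem (S i) s
    ; lower     = λ { p (i , e) → i , lower (S i) p e }
    ; inhabited = let (s , e) = inhabited (S i₀) in s , i₀ , e
    ; directed  = λ { {s} {t} (i , es) (j , et) →
        let (k , ik , jk) = dir i j
            (u , eu , su , tu) = directed (S k) (ik s es) (jk t et)
        in u , (k , eu) , su , tu }
    }

  _≪_ : Ideal A → Ideal A → Set₁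
  x ≪ y = ∀ {I : Set} (S : I → Ideal A) (d : Directed S) →
          y ⊑ ⨆ S d → ∃[ i ] (x ⊑ S i)

  ScottOpen : (Ideal A → Set) → Set₁
  ScottOpen U = (∀ {x y} → x ⊑ y → U x → U y)
              × (∀ {I : Set} (S : I → Ideal A) (d : Directed S) →
                   U (⨆ S d) → ∃[ i ] U (S i))

  Maximal : Ideal A → Set₁
  Maximal x = ∀ y → x ⊑ y → y ⊑ x

  Sharp : Ideal A → Set₁
  Sharp x = ∀ u v → u ≪ v → (u ≪ x) ⊎ (¬ (v ⊑ x))

  Separated : Ideal A → Ideal A → Set₁
  Separated v x = ∃[ U ] ∃[ V ] (ScottOpen U × ScottOpen V × U v × V x
                                 × (∀ z → U z → V z → ⊥))

  StronglyMaximal : Ideal A → Set₁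
  StronglyMaximal x = ∀ u v → u ≪ v → (u ≪ x) ⊎ Separated v x

Cantor : Set₁
Cantor = Ideal Bool

Baire : Set₁
Baire = Ideal ℕ

-- Markov's Principle (0 = false, 1 = true)
MarkovPrinciple : Set
MarkovPrinciple = ∀ (φ : ℕ → Bool) → ¬ (∀ n → φ n ≡ false) → ∃[ k ] (φ k ≡ true)

-- The strongly maximal ideals are exactly the total ones, those in which every finite
-- sequence extends by one more letter: a total ideal contains exactly one sequence of each
-- length, so every sequence either lies in it or is incomparable with one of its elements,
-- which separates; conversely a Scott open around a strongly maximal ideal is entered at
-- some finite stage, and a separating pair of opens rules out that this stage is a leaf.
-- Sharpness amounts to decidable membership, and a decidable maximal ideal has no leaf only
-- in the double-negated sense. Over {0,1} the two candidate extensions can be checked, over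
-- ℕ finding one is an instance of Markov's Principle. Conversely, for φ with ¬ ∀ n φ n = 0
-- the ideal {[]} ∪ {k 0ʲ : k least with φ k = 1} is sharp and maximal, and totality of it
-- produces k.
module Submission where

open import Defs
open import Data.Bool using (Bool; true; false)
open import Data.Bool.Properties using (¬-not)
import Data.Bool as Bool
open import Data.Empty using (⊥-elim)
open import Data.List using (List; []; _∷_; _++_; [_]; length; replicate)
open import Data.List.Properties using (++-assoc; ++-identityʳ; ∷-injective; length-++; length-replicate; ≡-dec)
open import Data.List.Relation.Unary.All using (All; []; _∷_; all?)
open import Data.List.Relation.Unary.All.Properties using (++⁻ˡ; replicate⁺)
open import Data.Nat using (ℕ; zero; suc; _<_; _≤_; s≤s)
import Data.Nat as ℕ
open import Data.Nat.Induction using (<-rec)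
open import Data.Nat.Properties using (suc-injective; m≤m+n; +-comm; <-cmp; <⇒≱; ≤-reflexive; anyUpTo?; allUpTo?)
open import Data.Product using (Σ; ∃; ∃-syntax; _×_; _,_; proj₁; proj₂)
open import Data.Sum using (_⊎_; inj₁; inj₂)
import Data.Sum as Sum
open import Data.Unit using (⊤; tt)
open import Function.Bundles using (_⇔_; mk⇔; Equivalence)
open import Relation.Binary using (tri<; tri≈; tri>)
open import Relation.Binary.Definitions using (DecidableEquality)
open import Relation.Binary.PropositionalEquality using (_≡_; refl; sym; trans; cong; subst)
open import Relation.Nullary using (¬_; Dec; yes; no; does; contradiction)
open import Relation.Nullary.Decidable using (_×-dec_)

module _ {A : Set} where

  ≼-refl : (s : List A) → s ≼ s
  ≼-refl s = [] , ++-identityʳ s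

  ≼-trans : {r s t : List A} → r ≼ s → s ≼ t → r ≼ t
  ≼-trans {r} (p , refl) (q , refl) = p ++ q , sym (++-assoc r p q)

  []≼ : (s : List A) → [] ≼ s
  []≼ s = s , refl

  ∷-≼ : (a : A) {s t : List A} → s ≼ t → (a ∷ s) ≼ (a ∷ t)
  ∷-≼ a (p , s++p≡t) = p , cong (a ∷_) s++p≡t

  ≼-length : {s t : List A} → s ≼ t → length s ≤ length t
  ≼-length {s} (p , refl) = subst (length s ≤_) (sym (length-++ s)) (m≤m+n _ _)

  ≼-length-≡ : {s t : List A} → s ≼ t → length s ≡ length t → s ≡ t
  ≼-length-≡ {[]}    ([] , refl) _       = refl
  ≼-length-≡ {a ∷ s} (p , refl)  |s|≡|t| = cong (a ∷_) (≼-length-≡ (p , refl) (suc-injective |s|≡|t|))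

  ≼-or-≽-of-++ : (s t p q : List A) → s ++ p ≡ t ++ q → s ≼ t ⊎ t ≼ s
  ≼-or-≽-of-++ []      t       p q eq = inj₁ ([]≼ t)
  ≼-or-≽-of-++ (a ∷ s) []      p q eq = inj₂ ([]≼ (a ∷ s))
  ≼-or-≽-of-++ (a ∷ s) (b ∷ t) p q eq with ∷-injective eq
  ... | refl , eq′ with ≼-or-≽-of-++ s t p q eq′
  ...   | inj₁ s≼t = inj₁ (∷-≼ a s≼t)
  ...   | inj₂ t≼s = inj₂ (∷-≼ a t≼s)

  ≼-comparable : {s t u : List A} → s ≼ u → t ≼ u → s ≼ t ⊎ t ≼ s
  ≼-comparable {s} {t} (p , s++p≡u) (q , t++q≡u) = ≼-or-≽-of-++ s t p q (trans s++p≡u (sym t++q≡u))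

  ≼⇒≽-or-extends : {s t : List A} → s ≼ t → t ≼ s ⊎ ∃[ a ] ((s ++ [ a ]) ≼ t)
  ≼⇒≽-or-extends {s} ([]    , refl) = inj₁ ([] , trans (++-identityʳ _) (++-identityʳ s))
  ≼⇒≽-or-extends {s} (a ∷ p , refl) = inj₂ (a , p , ++-assoc s [ a ] p)

  constant-comparable : {a : A} {r r′ : List A} → All (_≡ a) r → All (_≡ a) r′ → r ≼ r′ ⊎ r′ ≼ r
  constant-comparable []            _               = inj₁ ([]≼ _)
  constant-comparable (_ ∷ _)       []              = inj₂ ([]≼ _)
  constant-comparable {a} (refl ∷ r≡a) (refl ∷ r′≡a) =
    Sum.map (∷-≼ a) (∷-≼ a) (constant-comparable r≡a r′≡a)

  comparable⇒directed : {P : List A → Set} → (∀ {s t} → P s → P t → s ≼ t ⊎ t ≼ s) →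
                        ∀ {s t} → P s → P t → ∃[ u ] (P u × s ≼ u × t ≼ u)
  comparable⇒directed comparable {s} {t} Ps Pt with comparable Ps Pt
  ... | inj₁ s≼t = t , Pt , s≼t , ≼-refl t
  ... | inj₂ t≼s = s , Ps , ≼-refl s , t≼s

  Incomparable : List A → List A → Set
  Incomparable s t = ¬ (s ≼ t ⊎ t ≼ s)

  elem-comparable : (x : Ideal A) {s t : List A} → elem x s → elem x t → s ≼ t ⊎ t ≼ s
  elem-comparable x s∈x t∈x = let (_ , _ , s≼u , t≼u) = directed x s∈x t∈x in ≼-comparable s≼u t≼u

  elem⇒≼-or-extends : (x : Ideal A) {s t : List A} → elem x s → elem x t →
                      t ≼ s ⊎ ∃[ a ] ((s ++ [ a ]) ≼ t)
  elem⇒≼-or-extends x s∈x t∈x with elem-comparable x s∈x t∈x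
  ... | inj₁ s≼t = ≼⇒≽-or-extends s≼t
  ... | inj₂ t≼s = inj₁ t≼s

  infix 25 ↓_

  ↓_ : List A → Ideal A
  ↓ s = record
    { elem      = _≼ s
    ; lower     = ≼-trans
    ; inhabited = [] , []≼ s
    ; directed  = λ t≼s t′≼s → s , ≼-refl s , t≼s , t′≼s
    }

  ↓-⊑ : (x : Ideal A) {s : List A} → elem x s → ↓ s ⊑ x
  ↓-⊑ x s∈x t t≼s = lower x t≼s s∈x

  ↓-mono : {s t : List A} → s ≼ t → ↓ s ⊑ ↓ t
  ↓-mono s≼t r r≼s = ≼-trans r≼s s≼t

  approximants : (x : Ideal A) → Σ (List A) (elem x) → Ideal A
  approximants x (s , _) = ↓ s

  approximants-directed : (x : Ideal A) → Directed (approximants x)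
  approximants-directed x = inhabited x , λ (s , s∈x) (t , t∈x) →
    let (u , u∈x , s≼u , t≼u) = directed x s∈x t∈x
    in (u , u∈x) , ↓-mono s≼u , ↓-mono t≼u

  ⊑⨆approximants : (x : Ideal A) → x ⊑ ⨆ (approximants x) (approximants-directed x)
  ⊑⨆approximants x s s∈x = (s , s∈x) , ≼-refl s

  ≪⇒⊑↓ : {u v : Ideal A} → u ≪ v → ∃[ s ] (elem v s × u ⊑ ↓ s)
  ≪⇒⊑↓ {v = v} u≪v =
    let ((s , s∈v) , u⊑↓s) = u≪v (approximants v) (approximants-directed v) (⊑⨆approximants v)
    in s , s∈v , u⊑↓s

  ⊑↓⇒≪ : {u v : Ideal A} {s : List A} → elem v s → u ⊑ ↓ s → u ≪ v
  ⊑↓⇒≪ {s = s} s∈v u⊑↓s S d v⊑⨆S =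
    let (i , s∈Si) = v⊑⨆S s s∈v in i , λ t t∈u → lower (S i) (u⊑↓s t t∈u) s∈Si

  ↓-compact : (s : List A) → ↓ s ≪ ↓ s
  ↓-compact s = ⊑↓⇒≪ {↓ s} {↓ s} (≼-refl s) (λ _ t≼s → t≼s)

  ↓≪⇒elem : (x : Ideal A) {s : List A} → ↓ s ≪ x → elem x s
  ↓≪⇒elem x {s} ↓s≪x = let (t , t∈x , ↓s⊑↓t) = ≪⇒⊑↓ {↓ s} {x} ↓s≪x in lower x (↓s⊑↓t s (≼-refl s)) t∈x

  scottOpen-principal : {V : Ideal A → Set} → ScottOpen V → {x : Ideal A} → V x →
                        ∃[ t ] (elem x t × V (↓ t))
  scottOpen-principal (V-upper , V-inaccessible) {x} x∈V =
    let ((t , t∈x) , ↓t∈V) = V-inaccessible (approximants x) (approximants-directed x)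
                               (V-upper (⊑⨆approximants x) x∈V)
    in t , t∈x , ↓t∈V

  incomparable⇒separated : {v x : Ideal A} {s t : List A} → elem v s → elem x t →
                           Incomparable s t → Separated v x
  incomparable⇒separated {s = s} {t} s∈v t∈x s#t =
    (λ z → elem z s) , (λ z → elem z t) ,
    ((λ y⊑z → y⊑z s) , (λ _ _ s∈⨆ → s∈⨆)) ,
    ((λ y⊑z → y⊑z t) , (λ _ _ t∈⨆ → t∈⨆)) ,
    s∈v , t∈x , λ z s∈z t∈z → s#t (elem-comparable z s∈z t∈z)

  DecidableIdeal : Ideal A → Set
  DecidableIdeal x = ∀ s → Dec (elem x s)

  sharp⇒decidable : (x : Ideal A) → Sharp x → DecidableIdeal x
  sharp⇒decidable x sharp s with sharp (↓ s) (↓ s) (↓-compact s)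
  ... | inj₁ ↓s≪x  = yes (↓≪⇒elem x ↓s≪x)
  ... | inj₂ ↓s⋢x = no (λ s∈x → ↓s⋢x (↓-⊑ x s∈x))

  decidable⇒sharp : (x : Ideal A) → DecidableIdeal x → Sharp x
  decidable⇒sharp x x? u v u≪v with ≪⇒⊑↓ {u} {v} u≪v
  ... | s , s∈v , u⊑↓s with x? s
  ...   | yes s∈x = inj₁ (⊑↓⇒≪ {u} {x} s∈x u⊑↓s)
  ...   | no  s∉x = inj₂ (λ v⊑x → s∉x (v⊑x s s∈v))

  stronglyMaximal⇒sharp : (x : Ideal A) → StronglyMaximal x → Sharp x
  stronglyMaximal⇒sharp x sm u v u≪v with sm u v u≪v
  ... | inj₁ u≪x = inj₁ u≪x
  ... | inj₂ (_ , _ , (U-upper , _) , _ , v∈U , x∈V , disjoint) =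
        inj₂ (λ v⊑x → disjoint x (U-upper v⊑x v∈U) x∈V)

  stronglyMaximal⇒maximal : (x : Ideal A) → StronglyMaximal x → Maximal x
  stronglyMaximal⇒maximal x sm y x⊑y s s∈y with sm (↓ s) (↓ s) (↓-compact s)
  ... | inj₁ ↓s≪x = ↓≪⇒elem x ↓s≪x
  ... | inj₂ (_ , _ , (U-upper , _) , (V-upper , _) , ↓s∈U , x∈V , disjoint) =
        ⊥-elim (disjoint y (U-upper (↓-⊑ y s∈y) ↓s∈U) (V-upper x⊑y x∈V))

  Total : Ideal A → Set
  Total x = ∀ s → elem x s → ∃[ a ] elem x (s ++ [ a ])

  total⇒elem-of-length : (x : Ideal A) → Total x → ∀ n → ∃[ t ] (elem x t × length t ≡ n)
  total⇒elem-of-length x total zero = [] , lower x ([]≼ _) (proj₂ (inhabited x)) , refl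
  total⇒elem-of-length x total (suc n) with total⇒elem-of-length x total n
  ... | t , t∈x , refl =
        let (a , t⁺∈x) = total t t∈x in t ++ [ a ] , t⁺∈x , trans (length-++ t) (+-comm (length t) 1)

  total⇒elem-or-incomparable : DecidableEquality A → (x : Ideal A) → Total x →
                               ∀ s → elem x s ⊎ ∃[ t ] (elem x t × Incomparable s t)
  total⇒elem-or-incomparable _≟_ x total s with total⇒elem-of-length x total (length s)
  ... | t , t∈x , |t|≡|s| with ≡-dec _≟_ s t
  ...   | yes refl = inj₁ t∈x
  ...   | no  s≢t  = inj₂ (t , t∈x , λ
          { (inj₁ s≼t) → s≢t (≼-length-≡ s≼t (sym |t|≡|s|))
          ; (inj₂ t≼s) → s≢t (sym (≼-length-≡ t≼s |t|≡|s|)) })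

  total⇒stronglyMaximal : DecidableEquality A → (x : Ideal A) → Total x → StronglyMaximal x
  total⇒stronglyMaximal _≟_ x total u v u≪v with ≪⇒⊑↓ {u} {v} u≪v
  ... | s , s∈v , u⊑↓s with total⇒elem-or-incomparable _≟_ x total s
  ...   | inj₁ s∈x             = inj₁ (⊑↓⇒≪ {u} {x} s∈x u⊑↓s)
  ...   | inj₂ (t , t∈x , s#t) = inj₂ (incomparable⇒separated s∈v t∈x s#t)

  stronglyMaximal⇒total : A → (x : Ideal A) → StronglyMaximal x → Total x
  stronglyMaximal⇒total a x sm s s∈x with sm (↓ (s ++ [ a ])) (↓ (s ++ [ a ])) (↓-compact _)
  ... | inj₁ ↓s⁺≪x = a , ↓≪⇒elem x ↓s⁺≪x
  ... | inj₂ (_ , _ , _ , V-open , ↓s⁺∈U , x∈V , disjoint)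
    with scottOpen-principal V-open x∈V
  ...   | t , t∈x , ↓t∈V with elem⇒≼-or-extends x s∈x t∈x
  ...     | inj₂ (b , s⁺≼t) = b , lower x s⁺≼t t∈x
  ...     | inj₁ t≼s        = ⊥-elim (disjoint _ ↓s⁺∈U (proj₁ V-open (↓-mono t≼s⁺) ↓t∈V))
    where t≼s⁺ = ≼-trans t≼s ([ a ] , refl)

  -- If s had no extension in x then x ⊑ ↓ (s ++ [ a ]), and maximality would put s ++ [ a ] in x.
  maximal⇒¬¬extension : A → (x : Ideal A) → Maximal x → ∀ {s} → elem x s →
                        ¬ (∀ a → ¬ elem x (s ++ [ a ]))
  maximal⇒¬¬extension a x maximal {s} s∈x no-extension =
    no-extension a (maximal (↓ (s ++ [ a ])) x⊑↓s⁺ (s ++ [ a ]) (≼-refl _))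
    where
    x⊑↓s⁺ : x ⊑ ↓ (s ++ [ a ])
    x⊑↓s⁺ t t∈x with elem⇒≼-or-extends x s∈x t∈x
    ... | inj₁ t≼s        = ≼-trans t≼s ([ a ] , refl)
    ... | inj₂ (b , s⁺≼t) = ⊥-elim (no-extension b (lower x s⁺≼t t∈x))

  decidable⇒maximal : (x : Ideal A) → DecidableIdeal x →
                      (∀ t → ¬ elem x t → ¬ ¬ (∃[ s ] (elem x s × Incomparable s t))) → Maximal x
  decidable⇒maximal x x? outside⇒incomparable y x⊑y t t∈y with x? t
  ... | yes t∈x = t∈x
  ... | no  t∉x = ⊥-elim (outside⇒incomparable t t∉x λ (s , s∈x , s#t) →
                    s#t (elem-comparable y (x⊑y s s∈x) t∈y))

  stronglyMaximal⇔sharp×maximal : DecidableEquality A →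
                                  (∀ x → Sharp x → Maximal x → Total x) →
                                  (x : Ideal A) → StronglyMaximal x ⇔ (Sharp x × Maximal x)
  stronglyMaximal⇔sharp×maximal _≟_ sharp-maximal⇒total x = mk⇔
    (λ sm → stronglyMaximal⇒sharp x sm , stronglyMaximal⇒maximal x sm)
    (λ (sharp , maximal) → total⇒stronglyMaximal _≟_ x (sharp-maximal⇒total x sharp maximal))

cantor-sharp-maximal⇒total : (x : Cantor) → Sharp x → Maximal x → Total x
cantor-sharp-maximal⇒total x sharp maximal s s∈x
  with sharp⇒decidable x sharp (s ++ [ false ]) | sharp⇒decidable x sharp (s ++ [ true ])
... | yes s0∈x | _        = false , s0∈x
... | no  _    | yes s1∈x = true , s1∈x
... | no  s0∉x | no  s1∉x =
      ⊥-elim (maximal⇒¬¬extension false x maximal s∈x λ { false → s0∉x ; true → s1∉x })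

module _ {P : Set} where

  does≡true⇒ : (P? : Dec P) → does P? ≡ true → P
  does≡true⇒ (yes p) _ = p

  does≡false⇒¬ : (P? : Dec P) → does P? ≡ false → ¬ P
  does≡false⇒¬ (no ¬p) _ = ¬p

markov-decidable : MarkovPrinciple → {P : ℕ → Set} → (∀ n → Dec (P n)) →
                   ¬ (∀ n → ¬ P n) → ∃ P
markov-decidable mp P? ¬∀¬P =
  let (k , does-P?k) = mp (λ n → does (P? n)) (λ all-no → ¬∀¬P λ n → does≡false⇒¬ (P? n) (all-no n))
  in k , does≡true⇒ (P? k) does-P?k

baire-sharp-maximal⇒total : MarkovPrinciple → (x : Baire) → Sharp x → Maximal x → Total x
baire-sharp-maximal⇒total mp x sharp maximal s s∈x =
  markov-decidable mp (λ n → sharp⇒decidable x sharp (s ++ [ n ])) (maximal⇒¬¬extension 0 x maximal s∈x)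

module LeastWitness (φ : ℕ → Bool) where

  IsLeast : ℕ → Set
  IsLeast k = φ k ≡ true × (∀ {m} → m < k → φ m ≡ false)

  isLeast? : ∀ k → Dec (IsLeast k)
  isLeast? k = (φ k Bool.≟ true) ×-dec allUpTo? (λ m → φ m Bool.≟ false) k

  isLeast-unique : ∀ {k l} → IsLeast k → IsLeast l → k ≡ l
  isLeast-unique {k} {l} (φk , below-k) (φl , below-l) with <-cmp k l
  ... | tri< k<l _ _ = contradiction (trans (sym φk) (below-l k<l)) λ ()
  ... | tri≈ _ k≡l _ = k≡l
  ... | tri> _ _ l<k = contradiction (trans (sym φl) (below-k l<k)) λ ()

  least-witness : ∀ n → φ n ≡ true → ∃ IsLeast
  least-witness = <-rec (λ n → φ n ≡ true → ∃ IsLeast) search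
    where
    search : ∀ n → (∀ {m} → m < n → φ m ≡ true → ∃ IsLeast) → φ n ≡ true → ∃ IsLeast
    search n below φn with anyUpTo? (λ m → φ m Bool.≟ true) n
    ... | yes (m , m<n , φm) = below m<n φm
    ... | no  none           = n , φn , λ m<n → ¬-not (λ φm → none (_ , m<n , φm))

  ¬all-false⇒¬¬least : ¬ (∀ n → φ n ≡ false) → ¬ ¬ ∃ IsLeast
  ¬all-false⇒¬¬least ¬all-false no-least =
    ¬all-false λ n → ¬-not λ φn → no-least (least-witness n φn)

  Member : List ℕ → Set
  Member []      = ⊤
  Member (k ∷ r) = IsLeast k × All (_≡ 0) r

  member? : ∀ s → Dec (Member s)
  member? []      = yes tt
  member? (k ∷ r) = isLeast? k ×-dec all? (ℕ._≟ 0) r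

  member-lower : ∀ {s t} → s ≼ t → Member t → Member s
  member-lower {[]}    _          _               = tt
  member-lower {k ∷ r} (_ , refl) (least , zeros) = least , ++⁻ˡ r zeros

  member-comparable : ∀ {s t} → Member s → Member t → s ≼ t ⊎ t ≼ s
  member-comparable {[]}            _ _ = inj₁ ([]≼ _)
  member-comparable {_ ∷ _} {[]}    _ _ = inj₂ ([]≼ _)
  member-comparable {k ∷ _} {_ ∷ _} (least-k , zeros) (least-l , zeros′)
    with refl ← isLeast-unique least-k least-l =
    Sum.map (∷-≼ k) (∷-≼ k) (constant-comparable zeros zeros′)

  ideal : Baire
  ideal = record
    { elem      = Member
    ; lower     = member-lower
    ; inhabited = [] , tt
    ; directed  = comparable⇒directed member-comparable
    }

  -- Outside the ideal, t is incomparable with the member k 0^|t|, which is longer than t.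
  ideal-maximal : ¬ (∀ n → φ n ≡ false) → Maximal ideal
  ideal-maximal ¬all-false = decidable⇒maximal ideal member? λ t t∉ideal no-incomparable →
    ¬all-false⇒¬¬least ¬all-false λ (k , least) →
      let n      = length t
          member = least , replicate⁺ n refl
      in no-incomparable (k ∷ replicate n 0 , member , λ
           { (inj₁ w≼t) → <⇒≱ (s≤s (≤-reflexive (sym (length-replicate n)))) (≼-length w≼t)
           ; (inj₂ t≼w) → t∉ideal (member-lower t≼w member) })

characterisation⇒markov : (∀ (x : Baire) → StronglyMaximal x ⇔ (Sharp x × Maximal x)) →
                          MarkovPrinciple
characterisation⇒markov sm⇔sharp×maximal φ ¬all-false =
  let open LeastWitness φ
      sm = Equivalence.from (sm⇔sharp×maximal ideal)
             (decidable⇒sharp ideal member? , ideal-maximal ¬all-false)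
      (k , (φk , _) , _) = stronglyMaximal⇒total 0 ideal sm [] tt
  in k , φk

theorem7p7 : ((x : Cantor) → StronglyMaximal x ⇔ (Sharp x × Maximal x))
    × (((x : Baire) → StronglyMaximal x ⇔ (Sharp x × Maximal x)) ⇔ MarkovPrinciple)
theorem7p7 =
  stronglyMaximal⇔sharp×maximal Bool._≟_ cantor-sharp-maximal⇒total ,
  mk⇔ characterisation⇒markov
      (λ mp → stronglyMaximal⇔sharp×maximal ℕ._≟_ (baire-sharp-maximal⇒total mp))
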